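{- Let $X=\langle X,\tau,\le,X_0\rangle$ be a generalized Priestley space. Then $\langle X^*,\cap,X,\emptyset\rangle$ is a bounded distributive meet semi-lattice.
   Context: A meet semi-lattice is a poset in which any two elements have a greatest lower bound $\wedge$; it is distributive if whenever $b_1\wedge b_2\leq a$ there exist $c_1\ge b_1$, $c_2\ge b_2$ with $a=c_1\wedge c_2$; bounded means it has top and bottom. A Priestley space is a compact space with a partial order $\le$ such that if $x\not\le y$ there is a clopen upset containing $x$ and not $y$. For $X=\langle X,\tau,\le,X_0\rangle$ with $\langle X,\tau,\le\rangle$ a Priestley space and $X_0\subseteq X$, a clopen upset $U$ is admissible if $\mathrm{max}(X-U)\subseteq X_0$; $X^*$ is the set of admissible clopen upsets, and $\mathcal{I}_x=\{U\in X^*:x\notin U\}$. $X$ is a generalized Priestley space if: (1) $\langle X,\tau,\le\rangle$ is a Priestley space; (2) $X_0$ is dense in $X$; (3) for each $x\in X$ there is $y\in X_0$ with $x\le y$; (4) $x\in X_0$ iff for all $U,V\in\mathcal{I}_x$ there is $W\in\mathcal{I}_x$ with $U\cup V\subseteq W$; (5) for all $x,y$, $x\le y$ iff every $U\in X^*$ containing $x$ contains $y$. -}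

module Defs where

open import Level using (Level; 0ℓ; _⊔_) renaming (suc to lsuc)
open import Data.Product using (Σ; ∃; ∃-syntax; _×_; _,_; proj₁; proj₂)
open import Data.Nat using (ℕ)
open import Data.Fin using (Fin)
open import Relation.Nullary using (¬_)
open import Relation.Binary.Core using (Rel)
open import Relation.Binary.PropositionalEquality using (_≡_)
open import Relation.Binary.Structures using (IsPartialOrder)
open import Relation.Binary.Definitions using (Maximum; Minimum)
open import Relation.Binary.Lattice.Structures using (IsMeetSemilattice)
open import Relation.Unary using (Pred; _∈_; _∉_; _⊆_; _∩_; _∪_; ∁; ∅; U; _≐_)

-- Topological spaces (subsets of X are predicates X → Set).
-- Unions are stated predicatively: a (small) predicate that is
-- extensionally the union of a family of open sets is open.

record IsTopology {X : Set} (τ : Pred X 0ℓ → Set) : Set₂ where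
  field
    open-∅ : τ ∅
    open-U : τ U
    open-∩ : ∀ {A B} → τ A → τ B → τ (A ∩ B)
    open-⋃ : ∀ {I : Set₁} (A : I → Pred X 0ℓ) (B : Pred X 0ℓ) →
             (∀ i → τ (A i)) →
             (∀ x → (x ∈ B → ∃[ i ] (x ∈ A i)) × (∃[ i ] (x ∈ A i) → x ∈ B)) →
             τ B

IsCompact : {X : Set} (τ : Pred X 0ℓ → Set) → Set₂
IsCompact {X} τ =
  ∀ {I : Set₁} (A : I → Pred X 0ℓ) → (∀ i → τ (A i)) →
  (∀ x → ∃[ i ] (x ∈ A i)) →
  ∃[ n ] Σ (Fin n → I) λ f → ∀ x → ∃[ k ] (x ∈ A (f k))

module _ {X : Set} (τ : Pred X 0ℓ → Set) (_≤_ : Rel X 0ℓ) where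

  Clopen : Pred X 0ℓ → Set
  Clopen A = τ A × τ (∁ A)

  IsUpset : Pred X 0ℓ → Set
  IsUpset A = ∀ {x y} → x ≤ y → x ∈ A → y ∈ A

  IsMaxOf : Pred X 0ℓ → X → Set
  IsMaxOf S x = x ∈ S × (∀ y → x ≤ y → y ∈ S → y ≡ x)

  record IsPriestleySpace : Set₂ where
    field
      isTopology     : IsTopology τ
      compact        : IsCompact τ
      isPartialOrder : IsPartialOrder _≡_ _≤_
      separation     : ∀ x y → ¬ (x ≤ y) →
                       Σ (Pred X 0ℓ) λ A → Clopen A × IsUpset A × x ∈ A × y ∉ A

  module _ (X₀ : Pred X 0ℓ) where

    Admissible : Pred X 0ℓ → Set
    Admissible A = Clopen A × IsUpset A × (∀ x → IsMaxOf (∁ A) x → x ∈ X₀)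

    Adm : Set₁
    Adm = Σ (Pred X 0ℓ) Admissible

    𝓘 : X → Adm → Set
    𝓘 x A = x ∉ proj₁ A

    record IsGeneralizedPriestleySpace : Set₂ where
      field
        priestley : IsPriestleySpace
        dense     : ∀ A → τ A → ∃[ x ] (x ∈ A) → ∃[ x ] (x ∈ A × x ∈ X₀)
        below-X₀  : ∀ x → ∃[ y ] (y ∈ X₀ × x ≤ y)
        X₀-char   : ∀ x →
          (x ∈ X₀ → ∀ A B → 𝓘 x A → 𝓘 x B →
              Σ Adm λ W → 𝓘 x W × (proj₁ A ∪ proj₁ B) ⊆ proj₁ W)
          × ((∀ A B → 𝓘 x A → 𝓘 x B →
              Σ Adm λ W → 𝓘 x W × (proj₁ A ∪ proj₁ B) ⊆ proj₁ W) → x ∈ X₀)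
        ≤-char    : ∀ x y →
          (x ≤ y → ∀ (A : Adm) → x ∈ proj₁ A → y ∈ proj₁ A)
          × ((∀ (A : Adm) → x ∈ proj₁ A → y ∈ proj₁ A) → x ≤ y)

record IsBoundedDistributiveMeetSemilattice
  {a ℓ₁ ℓ₂ : Level} {A : Set a} (_≈_ : Rel A ℓ₁) (_≤_ : Rel A ℓ₂)
  (_∧_ : A → A → A) (⊤ ⊥ : A) : Set (a ⊔ ℓ₁ ⊔ ℓ₂) where
  field
    isMeetSemilattice : IsMeetSemilattice _≈_ _≤_ _∧_
    maximum           : Maximum _≤_ ⊤
    minimum           : Minimum _≤_ ⊥
    distributive      : ∀ a b₁ b₂ → (b₁ ∧ b₂) ≤ a →
      ∃[ c₁ ] ∃[ c₂ ] (b₁ ≤ c₁ × b₂ ≤ c₂ × a ≈ (c₁ ∧ c₂))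

_≐*_ : {X : Set} {P : Pred X 0ℓ → Set} → Rel (Σ (Pred X 0ℓ) P) 0ℓ
A ≐* B = proj₁ A ≐ proj₁ B

_⊆*_ : {X : Set} {P : Pred X 0ℓ → Set} → Rel (Σ (Pred X 0ℓ) P) 0ℓ
A ⊆* B = proj₁ A ⊆ proj₁ B

-- A ∩ B is again an admissible clopen upset: its complement ∁A ∪ ∁B is open, and a
-- maximal point of it outside A is maximal in ∁B (and symmetrically).
--
-- Distributivity: let B₁ ∩ B₂ ⊆ A.  Chains in the closed set ↑y ∩ ∁A have suprema by
-- compactness, so by Zorn each y ∉ A lies below some m maximal in ∁A, and m ∈ X₀.  As
-- m ∉ B₁ ∩ B₂, m misses A and some Bᵢ, so condition (4) yields an admissible W ⊇ A ∪ Bᵢ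
-- missing m, hence missing y.  Finitely many of these ∁W together with A cover X; the
-- intersections C₁, C₂ of the chosen W containing B₁, respectively B₂, satisfy
-- A = C₁ ∩ C₂.
module Submission where

open import Defs
open import Level using (0ℓ)
open import Axiom.ExcludedMiddle using (ExcludedMiddle)
open import Data.Empty using (⊥-elim)
open import Data.Fin using (Fin; zero; suc)
open import Data.Maybe using (Maybe; just; nothing)
open import Data.Nat using (zero; suc)
open import Data.Product using (Σ; Σ-syntax; _×_; _,_; proj₁; proj₂)
open import Data.Sum using (_⊎_; inj₁; inj₂)
open import Data.Unit using (tt)
open import Function using (_∘_)
open import Relation.Binary.Core using (Rel)
open import Relation.Binary.Lattice.Structures using (IsMeetSemilattice)
open import Relation.Binary.PropositionalEquality using (_≡_; _≢_; refl)
open import Relation.Binary.Structures using (IsPartialOrder)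
open import Relation.Nullary using (¬_; Dec; yes; no; contradiction)
open import Relation.Nullary.Decidable using (True; toWitness; fromWitness; decidable-stable)
open import Relation.Unary using (Pred; _∈_; _∉_; _⊆_; _∩_; _∪_; ∁; ∅; U)
open import Relation.Unary.Properties using (⊆-reflexive; ⊆-trans; ⊆-antisym; ≐-refl; ≐-sym; ≐-trans)

module _ {X : Set} {_≤_ : Rel X 0ℓ} (isPartialOrder : IsPartialOrder _≡_ _≤_) where
  open IsPartialOrder isPartialOrder using ()
    renaming (refl to ≤-refl; trans to ≤-trans; antisym to ≤-antisym)

  Chain : Pred X 0ℓ → Set
  Chain C = ∀ {a b} → a ∈ C → b ∈ C → a ≤ b ⊎ b ≤ a

  IsUpperBound : Pred X 0ℓ → X → Set
  IsUpperBound C u = ∀ {c} → c ∈ C → c ≤ u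

  IsLubIn : Pred X 0ℓ → Pred X 0ℓ → X → Set
  IsLubIn S C s = s ∈ S × IsUpperBound C s × (∀ {u} → u ∈ S → IsUpperBound C u → s ≤ u)

  ChainComplete : Pred X 0ℓ → Set₁
  ChainComplete S = ∀ C → C ⊆ S → Chain C → Σ X (IsLubIn S C)

  IsMaximalIn : Pred X 0ℓ → X → Set
  IsMaximalIn S m = m ∈ S × (∀ y → m ≤ y → y ∈ S → y ≡ m)

  chain-finite-upperBound : ∀ {D x} → Chain D → x ∈ D → ∀ n (g : Fin n → X) →
    (∀ k → g k ∈ D) → Σ X λ m → m ∈ D × (∀ k → g k ≤ m)
  chain-finite-upperBound ch x∈D zero g g∈D = _ , x∈D , λ ()
  chain-finite-upperBound ch x∈D (suc n) g g∈D
    with chain-finite-upperBound ch x∈D n (g ∘ suc) (g∈D ∘ suc)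
  ... | m , m∈D , ub with ch (g∈D zero) m∈D
  ...   | inj₁ g₀≤m = m , m∈D , λ { zero → g₀≤m ; (suc k) → ub k }
  ...   | inj₂ m≤g₀ = g zero , g∈D zero , λ { zero → ≤-refl ; (suc k) → ≤-trans (ub k) m≤g₀ }

  module _ (em : ∀ {ℓ} → ExcludedMiddle ℓ) {S : Pred X 0ℓ} (complete : ChainComplete S) where

    sup : ∀ C → C ⊆ S → Chain C → X
    sup C C⊆S ch = proj₁ (complete C C⊆S ch)

    sup∈S : ∀ C (C⊆S : C ⊆ S) (ch : Chain C) → sup C C⊆S ch ∈ S
    sup∈S C C⊆S ch = proj₁ (proj₂ (complete C C⊆S ch))

    sup-upper : ∀ C (C⊆S : C ⊆ S) (ch : Chain C) → IsUpperBound C (sup C C⊆S ch)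
    sup-upper C C⊆S ch = proj₁ (proj₂ (proj₂ (complete C C⊆S ch)))

    sup-least : ∀ C (C⊆S : C ⊆ S) (ch : Chain C) {u} → u ∈ S → IsUpperBound C u → sup C C⊆S ch ≤ u
    sup-least C C⊆S ch = proj₂ (proj₂ (proj₂ (complete C C⊆S ch)))

    module BourbakiWitt (h : X → X) (h-closed : ∀ {y} → y ∈ S → h y ∈ S)
                        (h-inflationary : ∀ y → y ≤ h y) where

      data Tower : X → Set₁ where
        step : ∀ {y} → Tower y → Tower (h y)
        lim  : ∀ C (C⊆S : C ⊆ S) (ch : Chain C) → (∀ {y} → y ∈ C → Tower y) →
               Tower (sup C C⊆S ch)

      tower⊆S : ∀ {y} → Tower y → y ∈ S
      tower⊆S (step t) = h-closed (tower⊆S t)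
      tower⊆S (lim C C⊆S ch _) = sup∈S C C⊆S ch

      Extreme : X → Set₁
      Extreme c = ∀ {y} → Tower y → y ≤ c → y ≢ c → h y ≤ c

      extreme-splits : ∀ {c} → c ∈ S → Extreme c → ∀ {y} → Tower y → y ≤ c ⊎ h c ≤ y
      extreme-splits {c} c∈S ext (step {y} t) with extreme-splits c∈S ext t
      ... | inj₂ hc≤y = inj₂ (≤-trans hc≤y (h-inflationary y))
      ... | inj₁ y≤c with em {P = y ≡ c}
      ...   | yes refl = inj₂ ≤-refl
      ...   | no y≢c = inj₁ (ext t y≤c y≢c)
      extreme-splits {c} c∈S ext (lim C C⊆S ch ts) with em {P = Σ X λ z → z ∈ C × h c ≤ z}
      ... | yes (z , z∈C , hc≤z) = inj₂ (≤-trans hc≤z (sup-upper C C⊆S ch z∈C))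
      ... | no ∄z = inj₁ (sup-least C C⊆S ch c∈S below-c)
        where
        below-c : IsUpperBound C c
        below-c z∈C with extreme-splits c∈S ext (ts z∈C)
        ... | inj₁ z≤c = z≤c
        ... | inj₂ hc≤z = contradiction (_ , z∈C , hc≤z) ∄z

      tower-extreme : ∀ {c} → Tower c → Extreme c
      tower-extreme (step {c} tc) {y} ty y≤hc y≢hc
        with extreme-splits (tower⊆S tc) (tower-extreme tc) ty
      ... | inj₂ hc≤y = contradiction (≤-antisym y≤hc hc≤y) y≢hc
      ... | inj₁ y≤c with em {P = y ≡ c}
      ...   | yes refl = ≤-refl
      ...   | no y≢c = ≤-trans (tower-extreme tc ty y≤c y≢c) (h-inflationary c)
      tower-extreme (lim C C⊆S ch tC) {y} ty y≤s y≢s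
        with em {P = Σ X λ w → w ∈ C × ¬ w ≤ y}
      ... | no ∄w = contradiction (≤-antisym y≤s (sup-least C C⊆S ch (tower⊆S ty) y-ub)) y≢s
        where
        y-ub : IsUpperBound C y
        y-ub {w} w∈C = decidable-stable em λ w≰y → ∄w (w , w∈C , w≰y)
      ... | yes (w , w∈C , w≰y)
        with extreme-splits (C⊆S w∈C) (tower-extreme (tC w∈C)) ty
      ...   | inj₂ hw≤y = contradiction (≤-trans (h-inflationary w) hw≤y) w≰y
      ...   | inj₁ y≤w with em {P = y ≡ w}
      ...     | yes refl = contradiction ≤-refl w≰y
      ...     | no y≢w = ≤-trans (tower-extreme (tC w∈C) ty y≤w y≢w)
                                 (sup-upper C C⊆S ch w∈C)

      tower-chain : ∀ {a b} → Tower a → Tower b → a ≤ b ⊎ b ≤ a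
      tower-chain ta tb with extreme-splits (tower⊆S ta) (tower-extreme ta) tb
      ... | inj₁ b≤a = inj₂ b≤a
      ... | inj₂ ha≤b = inj₁ (≤-trans (h-inflationary _) ha≤b)

      -- Tower lives in Set₁; deciding it squashes the tower into a small predicate.
      InTower : Pred X 0ℓ
      InTower y = True (em {P = Tower y})

      fixed-point : Σ X λ s → s ∈ S × h s ≡ s
      fixed-point = s , tower⊆S s-tower ,
        ≤-antisym (sup-upper InTower InTower⊆S InTower-chain (fromWitness (step s-tower)))
                  (h-inflationary s)
        where
        InTower⊆S : InTower ⊆ S
        InTower⊆S r = tower⊆S (toWitness r)
        InTower-chain : Chain InTower
        InTower-chain ra rb = tower-chain (toWitness ra) (toWitness rb)
        s = sup InTower InTower⊆S InTower-chain
        s-tower : Tower s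
        s-tower = lim InTower InTower⊆S InTower-chain toWitness

    StrictlyAbove : X → Set
    StrictlyAbove y = Σ X λ z → z ∈ S × y ≤ z × z ≢ y

    next : ∀ y → Dec (StrictlyAbove y) → X
    next y (yes (z , _)) = z
    next y (no _) = y

    next-closed : ∀ {y} d → y ∈ S → next y d ∈ S
    next-closed (yes (_ , z∈S , _)) _ = z∈S
    next-closed (no _) y∈S = y∈S

    next-inflationary : ∀ y d → y ≤ next y d
    next-inflationary y (yes (_ , _ , y≤z , _)) = y≤z
    next-inflationary y (no _) = ≤-refl

    next-moves : ∀ {y} d → StrictlyAbove y → next y d ≢ y
    next-moves (yes (_ , _ , _ , z≢y)) _ = z≢y
    next-moves (no ∄z) z = contradiction z ∄z

    zorn : Σ X (IsMaximalIn S)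
    zorn = s , s∈S , λ y s≤y y∈S → decidable-stable em λ y≢s →
             next-moves em (y , y∈S , s≤y , y≢s) hs≡s
      where
      open BourbakiWitt (λ y → next y em) (next-closed em) (λ y → next-inflationary y em)
      s = proj₁ fixed-point
      s∈S = proj₁ (proj₂ fixed-point)
      hs≡s = proj₂ (proj₂ fixed-point)

module _ {X : Set} {τ : Pred X 0ℓ → Set} (isTopology : IsTopology τ) where
  open IsTopology isTopology

  locally-open⇒open : ∀ B → (∀ {y} → y ∈ B → Σ (Pred X 0ℓ) λ W → τ W × W ⊆ B × y ∈ W) → τ B
  locally-open⇒open B nbhd =
    open-⋃ {I = Σ (Pred X 0ℓ) λ W → τ W × W ⊆ B} proj₁ B (proj₁ ∘ proj₂) λ y →
      (λ y∈B → let W , W-open , W⊆B , y∈W = nbhd y∈B in (W , W-open , W⊆B) , y∈W) ,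
      (λ ((_ , _ , W⊆B) , y∈W) → W⊆B y∈W)

  ∁U-open : τ (∁ U)
  ∁U-open = locally-open⇒open (∁ U) λ y∉U → ⊥-elim (y∉U tt)

  ∁∅-open : τ (∁ ∅)
  ∁∅-open = locally-open⇒open (∁ ∅) λ _ → U , open-U , (λ _ ()) , tt

  ∁∩-open : (∀ {ℓ} → ExcludedMiddle ℓ) → ∀ {A B} → τ (∁ A) → τ (∁ B) → τ (∁ (A ∩ B))
  ∁∩-open em {A} {B} ∁A-open ∁B-open = locally-open⇒open (∁ (A ∩ B)) nbhd
    where
    nbhd : ∀ {y} → y ∉ A ∩ B → Σ (Pred X 0ℓ) λ W → τ W × W ⊆ ∁ (A ∩ B) × y ∈ W
    nbhd {y} y∉A∩B with em {P = y ∈ A}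
    ... | yes y∈A = ∁ B , ∁B-open , (λ z∉B z∈A∩B → z∉B (proj₂ z∈A∩B)) , λ y∈B → y∉A∩B (y∈A , y∈B)
    ... | no y∉A = ∁ A , ∁A-open , (λ z∉A z∈A∩B → z∉A (proj₁ z∈A∩B)) , y∉A

compact-fip : (∀ {ℓ} → ExcludedMiddle ℓ) → {X : Set} {τ : Pred X 0ℓ → Set} → IsCompact τ →
  {I : Set₁} (O : I → Pred X 0ℓ) → (∀ i → τ (O i)) →
  (∀ n (f : Fin n → I) → Σ X λ y → ∀ k → y ∉ O (f k)) → Σ X λ y → ∀ i → y ∉ O i
compact-fip em compact O O-open finite = decidable-stable em λ ∄y →
  let covers y = decidable-stable em λ ∄i → ∄y (y , λ i y∈Oi → ∄i (i , y∈Oi))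
      n , f , finite-cover = compact O O-open covers
      y , y∉O = finite n f
      k , y∈O = finite-cover y
  in y∉O k y∈O

module Priestley (em : ∀ {ℓ} → ExcludedMiddle ℓ) {X : Set} {τ : Pred X 0ℓ → Set} {_≤_ : Rel X 0ℓ}
                 (priestley : IsPriestleySpace τ _≤_) where
  open IsPriestleySpace priestley
  open IsPartialOrder isPartialOrder using () renaming (refl to ≤-refl; trans to ≤-trans)

  not-above-open : ∀ c → τ (λ y → ¬ c ≤ y)
  not-above-open c = locally-open⇒open isTopology _ λ {y} c≰y →
    let W , (_ , ∁W-open) , W-up , c∈W , y∉W = separation c y c≰y
    in ∁ W , ∁W-open , (λ z∉W c≤z → z∉W (W-up c≤z c∈W)) , y∉W

  not-below-open : ∀ u → τ (λ y → ¬ y ≤ u)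
  not-below-open u = locally-open⇒open isTopology _ λ {y} y≰u →
    let W , (W-open , _) , W-up , y∈W , u∉W = separation y u y≰u
    in W , W-open , (λ z∈W z≤u → u∉W (W-up z≤u z∈W)) , y∈W

  module ChainLub (A : Pred X 0ℓ) (A-open : τ A) (x : X) (x∉A : x ∉ A) where

    S : Pred X 0ℓ
    S y = x ≤ y × y ∉ A

    module _ (C : Pred X 0ℓ) (C⊆S : C ⊆ S) (ch : Chain isPartialOrder C) where

      -- The lub is the common point of the closed sets ∁A, ↑x, ↑c (c ∈ C) and ↓u (u an
      -- upper bound in S); each is represented by its open complement.
      data Condition : Set₁ where
        outside-A above-x : Condition
        above : ∀ c → c ∈ C → Condition
        below : ∀ u → u ∈ S → IsUpperBound isPartialOrder C u → Condition

      violates : Condition → Pred X 0ℓ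
      violates outside-A = A
      violates above-x y = ¬ x ≤ y
      violates (above c _) y = ¬ c ≤ y
      violates (below u _ _) y = ¬ y ≤ u

      violates-open : ∀ i → τ (violates i)
      violates-open outside-A = A-open
      violates-open above-x = not-above-open x
      violates-open (above c _) = not-above-open c
      violates-open (below u _ _) = not-below-open u

      -- Adjoining x makes C⁺ nonempty, so any finitely many conditions hold at its largest anchor.
      C⁺ : Pred X 0ℓ
      C⁺ y = y ≡ x ⊎ y ∈ C

      C⁺-chain : Chain isPartialOrder C⁺
      C⁺-chain (inj₁ refl) (inj₁ refl) = inj₁ ≤-refl
      C⁺-chain (inj₁ refl) (inj₂ b∈C) = inj₁ (proj₁ (C⊆S b∈C))
      C⁺-chain (inj₂ a∈C) (inj₁ refl) = inj₂ (proj₁ (C⊆S a∈C))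
      C⁺-chain (inj₂ a∈C) (inj₂ b∈C) = ch a∈C b∈C

      C⁺⊆S : C⁺ ⊆ S
      C⁺⊆S (inj₁ refl) = ≤-refl , x∉A
      C⁺⊆S (inj₂ m∈C) = C⊆S m∈C

      anchor : Condition → X
      anchor (above c _) = c
      anchor _ = x

      anchor∈C⁺ : ∀ i → anchor i ∈ C⁺
      anchor∈C⁺ outside-A = inj₁ refl
      anchor∈C⁺ above-x = inj₁ refl
      anchor∈C⁺ (above c c∈C) = inj₂ c∈C
      anchor∈C⁺ (below _ _ _) = inj₁ refl

      satisfies : ∀ i {m} → m ∈ C⁺ → anchor i ≤ m → m ∉ violates i
      satisfies outside-A m∈C⁺ _ = proj₂ (C⁺⊆S m∈C⁺)
      satisfies above-x m∈C⁺ _ x≰m = x≰m (proj₁ (C⁺⊆S m∈C⁺))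
      satisfies (above c _) _ c≤m c≰m = c≰m c≤m
      satisfies (below u u∈S _) (inj₁ refl) _ x≰u = x≰u (proj₁ u∈S)
      satisfies (below u _ u-ub) (inj₂ m∈C) _ m≰u = m≰u (u-ub m∈C)

      finitely-satisfiable : ∀ n (f : Fin n → Condition) → Σ X λ m → ∀ k → m ∉ violates (f k)
      finitely-satisfiable n f =
        let m , m∈C⁺ , ub = chain-finite-upperBound isPartialOrder C⁺-chain (inj₁ refl) n
                              (anchor ∘ f) (anchor∈C⁺ ∘ f)
        in m , λ k → satisfies (f k) m∈C⁺ (ub k)

      lub : Σ X (IsLubIn isPartialOrder S C)
      lub = s , (dne (s∉ above-x) , s∉ outside-A) ,
            (λ {c} c∈C → dne (s∉ (above c c∈C))) ,
            (λ {u} u∈S u-ub → dne (s∉ (below u u∈S u-ub)))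
        where
        dne : ∀ {P : Set} → ¬ ¬ P → P
        dne = decidable-stable em
        point = compact-fip em {τ = τ} compact violates violates-open finitely-satisfiable
        s = proj₁ point
        s∉ = proj₂ point

  maximal-above : ∀ A → τ A → ∀ {x} → x ∉ A → Σ X λ m → x ≤ m × IsMaxOf τ _≤_ (∁ A) m
  maximal-above A A-open {x} x∉A =
    let m , (x≤m , m∉A) , m-max = zorn isPartialOrder em {S} lub
    in m , x≤m , m∉A , λ y m≤y y∉A → m-max y m≤y (≤-trans x≤m m≤y , y∉A)
    where open ChainLub A A-open x x∉A

∩-isMeetSemilattice : {X : Set} {P : Pred X 0ℓ → Set} (∩-closed : ∀ A B → P A → P B → P (A ∩ B)) →
  IsMeetSemilattice {A = Σ (Pred X 0ℓ) P} _≐*_ _⊆*_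
    (λ A B → proj₁ A ∩ proj₁ B , ∩-closed (proj₁ A) (proj₁ B) (proj₂ A) (proj₂ B))
∩-isMeetSemilattice ∩-closed = record
  { isPartialOrder = record
    { isPreorder = record
      { isEquivalence = record { refl = ≐-refl ; sym = ≐-sym ; trans = ≐-trans }
      ; reflexive = ⊆-reflexive
      ; trans = ⊆-trans
      }
    ; antisym = ⊆-antisym
    }
  ; infimum = λ _ _ → proj₁ , proj₂ , λ _ C⊆A C⊆B z∈C → C⊆A z∈C , C⊆B z∈C
  }

module GeneralizedPriestley (em : ∀ {ℓ} → ExcludedMiddle ℓ) {X : Set} {τ : Pred X 0ℓ → Set}
         {_≤_ : Rel X 0ℓ} {X₀ : Pred X 0ℓ} (G : IsGeneralizedPriestleySpace τ _≤_ X₀) where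
  open IsGeneralizedPriestleySpace G
  open IsPriestleySpace priestley
  open IsTopology isTopology
  open Priestley em priestley using (maximal-above)

  X* : Set₁
  X* = Adm τ _≤_ X₀

  ∩-admissible : ∀ A B → Admissible τ _≤_ X₀ A → Admissible τ _≤_ X₀ B →
                 Admissible τ _≤_ X₀ (A ∩ B)
  ∩-admissible A B ((A-open , ∁A-open) , A-up , A-max) ((B-open , ∁B-open) , B-up , B-max) =
    (open-∩ A-open B-open , ∁∩-open isTopology em ∁A-open ∁B-open) ,
    (λ x≤y (x∈A , x∈B) → A-up x≤y x∈A , B-up x≤y x∈B) ,
    max
    where
    max : ∀ x → IsMaxOf τ _≤_ (∁ (A ∩ B)) x → x ∈ X₀
    max x (x∉A∩B , x-max) with em {P = x ∈ A}
    ... | yes x∈A = B-max x ((λ x∈B → x∉A∩B (x∈A , x∈B)) , λ y x≤y y∉B → x-max y x≤y (y∉B ∘ proj₂))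
    ... | no x∉A = A-max x (x∉A , λ y x≤y y∉A → x-max y x≤y (y∉A ∘ proj₁))

  U-admissible : Admissible τ _≤_ X₀ U
  U-admissible = (open-U , ∁U-open isTopology) , (λ _ _ → tt) , λ x x-max → ⊥-elim (proj₁ x-max tt)

  ∅-admissible : Admissible τ _≤_ X₀ ∅
  ∅-admissible = (open-∅ , ∁∅-open isTopology) , (λ _ ()) , max
    where
    max : ∀ x → IsMaxOf τ _≤_ (∁ ∅) x → x ∈ X₀
    max x (_ , x-max) with below-X₀ x
    ... | y , y∈X₀ , x≤y with x-max y x≤y (λ ())
    ...   | refl = y∈X₀

  X*-open : (W : X*) → τ (proj₁ W)
  X*-open W = proj₁ (proj₁ (proj₂ W))

  X*-∁open : (W : X*) → τ (∁ (proj₁ W))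
  X*-∁open W = proj₂ (proj₁ (proj₂ W))

  X*-upset : (W : X*) → IsUpset τ _≤_ (proj₁ W)
  X*-upset W = proj₁ (proj₂ (proj₂ W))

  X*-maxima : (W : X*) → ∀ m → IsMaxOf τ _≤_ (∁ (proj₁ W)) m → m ∈ X₀
  X*-maxima W = proj₂ (proj₂ (proj₂ W))

  below-X₀-outside : (W : X*) → ∀ {y} → y ∉ proj₁ W → Σ X λ m → y ≤ m × m ∉ proj₁ W × m ∈ X₀
  below-X₀-outside W y∉W =
    let m , y≤m , m-max = maximal-above (proj₁ W) (X*-open W) y∉W
    in m , y≤m , proj₁ m-max , X*-maxima W m m-max

  join : ∀ {m} → m ∈ X₀ → (V W : X*) → m ∉ proj₁ V → m ∉ proj₁ W →
         Σ X* λ Z → m ∉ proj₁ Z × (proj₁ V ∪ proj₁ W) ⊆ proj₁ Z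
  join {m} m∈X₀ = proj₁ (X₀-char m) m∈X₀

  _∧_ : X* → X* → X*
  A ∧ B = proj₁ A ∩ proj₁ B , ∩-admissible (proj₁ A) (proj₁ B) (proj₂ A) (proj₂ B)

  ⊤* : X*
  ⊤* = U , U-admissible

  ⋂* : ∀ n → (Fin n → X*) → X*
  ⋂* zero _ = ⊤*
  ⋂* (suc n) W = W zero ∧ ⋂* n (W ∘ suc)

  ⊆-⋂* : ∀ n (W : Fin n → X*) {B : Pred X 0ℓ} → (∀ k → B ⊆ proj₁ (W k)) → B ⊆ proj₁ (⋂* n W)
  ⊆-⋂* zero W _ _ = tt
  ⊆-⋂* (suc n) W B⊆W y∈B = B⊆W zero y∈B , ⊆-⋂* n (W ∘ suc) (λ k → B⊆W (suc k)) y∈B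

  ⋂*-⊆ : ∀ n (W : Fin n → X*) k → ⋂* n W ⊆* W k
  ⋂*-⊆ (suc n) W zero = proj₁
  ⋂*-⊆ (suc n) W (suc k) = ⋂*-⊆ n (W ∘ suc) k ∘ proj₂

  module Distributivity (A B₁ B₂ : X*) (B₁∧B₂⊆A : (B₁ ∧ B₂) ⊆* A) where

    Separating : X* → Set
    Separating W = A ⊆* W × (B₁ ⊆* W ⊎ B₂ ⊆* W)

    separate-below : ∀ {y m} → y ≤ m → m ∉ proj₁ A → m ∈ X₀ → Dec (m ∈ proj₁ B₁) →
                     Σ X* λ W → Separating W × y ∉ proj₁ W
    separate-below y≤m m∉A m∈X₀ (yes m∈B₁) =
      let W , m∉W , A∪B₂⊆W = join m∈X₀ A B₂ m∉A λ m∈B₂ → m∉A (B₁∧B₂⊆A (m∈B₁ , m∈B₂))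
      in W , ((λ z∈A → A∪B₂⊆W (inj₁ z∈A)) , inj₂ (λ z∈B₂ → A∪B₂⊆W (inj₂ z∈B₂))) ,
         λ y∈W → m∉W (X*-upset W y≤m y∈W)
    separate-below y≤m m∉A m∈X₀ (no m∉B₁) =
      let W , m∉W , A∪B₁⊆W = join m∈X₀ A B₁ m∉A m∉B₁
      in W , ((λ z∈A → A∪B₁⊆W (inj₁ z∈A)) , inj₁ (λ z∈B₁ → A∪B₁⊆W (inj₂ z∈B₁))) ,
         λ y∈W → m∉W (X*-upset W y≤m y∈W)

    separate : ∀ {y} → y ∉ proj₁ A → Σ X* λ W → Separating W × y ∉ proj₁ W
    separate y∉A =
      let m , y≤m , m∉A , m∈X₀ = below-X₀-outside A y∉A
      in separate-below y≤m m∉A m∈X₀ em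

    Piece : Set₁
    Piece = Maybe (Σ X* Separating)

    region : Piece → Pred X 0ℓ
    region nothing = proj₁ A
    region (just (W , _)) = ∁ (proj₁ W)

    region-open : ∀ i → τ (region i)
    region-open nothing = X*-open A
    region-open (just (W , _)) = X*-∁open W

    covered-by : ∀ {y} → Dec (y ∈ proj₁ A) → Σ Piece λ i → y ∈ region i
    covered-by (yes y∈A) = nothing , y∈A
    covered-by (no y∉A) = let W , separating , y∉W = separate y∉A in just (W , separating) , y∉W

    left right : Piece → X*
    left (just (W , _ , inj₁ _)) = W
    left _ = ⊤*
    right (just (W , _ , inj₂ _)) = W
    right _ = ⊤*

    A⊆left : ∀ i → A ⊆* left i
    A⊆left nothing _ = tt
    A⊆left (just (_ , A⊆W , inj₁ _)) = A⊆W
    A⊆left (just (_ , _ , inj₂ _)) _ = tt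

    A⊆right : ∀ i → A ⊆* right i
    A⊆right nothing _ = tt
    A⊆right (just (_ , _ , inj₁ _)) _ = tt
    A⊆right (just (_ , A⊆W , inj₂ _)) = A⊆W

    B₁⊆left : ∀ i → B₁ ⊆* left i
    B₁⊆left (just (_ , _ , inj₁ B₁⊆W)) = B₁⊆W
    B₁⊆left (just (_ , _ , inj₂ _)) _ = tt
    B₁⊆left nothing _ = tt

    B₂⊆right : ∀ i → B₂ ⊆* right i
    B₂⊆right (just (_ , _ , inj₁ _)) _ = tt
    B₂⊆right (just (_ , _ , inj₂ B₂⊆W)) = B₂⊆W
    B₂⊆right nothing _ = tt

    region∩left∩right⊆A : ∀ i → region i ∩ proj₁ (left i ∧ right i) ⊆ proj₁ A
    region∩left∩right⊆A nothing (y∈A , _) = y∈A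
    region∩left∩right⊆A (just (_ , _ , inj₁ _)) (y∉W , y∈W , _) = contradiction y∈W y∉W
    region∩left∩right⊆A (just (_ , _ , inj₂ _)) (y∉W , _ , y∈W) = contradiction y∈W y∉W

    distributive : Σ X* λ C₁ → Σ X* λ C₂ → B₁ ⊆* C₁ × B₂ ⊆* C₂ × A ≐* (C₁ ∧ C₂)
    distributive =
      let n , f , finite-cover = compact region region-open (λ _ → covered-by em) in
      ⋂* n (left ∘ f) , ⋂* n (right ∘ f) ,
      ⊆-⋂* n (left ∘ f) (B₁⊆left ∘ f) , ⊆-⋂* n (right ∘ f) (B₂⊆right ∘ f) ,
      (λ y∈A → ⊆-⋂* n (left ∘ f) (A⊆left ∘ f) y∈A , ⊆-⋂* n (right ∘ f) (A⊆right ∘ f) y∈A) ,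
      λ {y} (y∈C₁ , y∈C₂) →
        let k , y∈region = finite-cover y
        in region∩left∩right⊆A (f k)
             (y∈region , ⋂*-⊆ n (left ∘ f) k y∈C₁ , ⋂*-⊆ n (right ∘ f) k y∈C₂)

proposition6p14 : (∀ {ℓ} → ExcludedMiddle ℓ) →
    {X : Set} (τ : Pred X 0ℓ → Set) (_≤_ : Rel X 0ℓ) (X₀ : Pred X 0ℓ) →
    IsGeneralizedPriestleySpace τ _≤_ X₀ →
    Σ[ ∩-adm ∈ (∀ A B → Admissible τ _≤_ X₀ A → Admissible τ _≤_ X₀ B → Admissible τ _≤_ X₀ (A ∩ B)) ]
    Σ[ U-adm ∈ Admissible τ _≤_ X₀ U ]
    Σ[ ∅-adm ∈ Admissible τ _≤_ X₀ ∅ ]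
    IsBoundedDistributiveMeetSemilattice {A = Adm τ _≤_ X₀} _≐*_ _⊆*_
    (λ A B → (proj₁ A ∩ proj₁ B , ∩-adm (proj₁ A) (proj₁ B) (proj₂ A) (proj₂ B)))
    (U , U-adm) (∅ , ∅-adm)
proposition6p14 em τ _≤_ X₀ G = ∩-admissible , U-admissible , ∅-admissible , record
  { isMeetSemilattice = ∩-isMeetSemilattice ∩-admissible
  ; maximum = λ _ _ → tt
  ; minimum = λ _ ()
  ; distributive = λ A B₁ B₂ B₁∧B₂⊆A → Distributivity.distributive A B₁ B₂ B₁∧B₂⊆A
  }
  where open GeneralizedPriestley em G
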